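{- $\sqsupseteq_{CS}^\Delta$ is a precongruence for renaming: for every $f:\Sigma\to\Sigma$ and all CSP processes $P,Q$, if $P\sqsupseteq_{CS}^\Delta Q$ then $f(P)\sqsupseteq_{CS}^\Delta f(Q)$.
   Context: Fix a set $\Sigma$ of communications and an internal action $\tau\notin\Sigma$; $a$ ranges over $\Sigma$ and $\alpha$ over $\Sigma\cup\{\tau\}$. CSP expressions are generated by $P,Q ::= \mathrm{STOP}\mid \mathrm{div}\mid a\to P\mid P\sqcap Q\mid P\,\Box\,Q\mid P\rhd Q\mid P\,\|_A\,Q\mid P\setminus A\mid f(P)\mid P\,\triangle\,Q\mid P\,\Theta_A\,Q\mid X\mid \mu X.P$, with $A\subseteq\Sigma$, $f:\Sigma\to\Sigma$ (extended by $f(\tau)=\tau$), $X$ a process identifier. A CSP process is an expression in which every occurrence of an identifier $X$ lies within a subexpression $\mu X.P$. Transitions $P\xrightarrow{\alpha}P'$ are the least relations such that: $\mathrm{div}\xrightarrow{\tau}\mathrm{div}$; $(a\to P)\xrightarrow{a}P$; $P\sqcap Q\xrightarrow{\tau}P$, $P\sqcap Q\xrightarrow{\tau}Q$; if $P\xrightarrow{a}P'$ then $P\Box Q\xrightarrow{a}P'$, $Q\Box P\xrightarrow{a}P'$, $P\rhd Q\xrightarrow{a}P'$; if $P\xrightarrow{\tau}P'$ then $P\Box Q\xrightarrow{\tau}P'\Box Q$, $Q\Box P\xrightarrow{\tau}Q\Box P'$, $P\rhd Q\xrightarrow{\tau}P'\rhd Q$; $P\rhd Q\xrightarrow{\tau}Q$;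 if $P\xrightarrow{\alpha}P'$ then $f(P)\xrightarrow{f(\alpha)}f(P')$; if $P\xrightarrow{\alpha}P'$, $\alpha\notin A$, then $P\|_AQ\xrightarrow{\alpha}P'\|_AQ$, $Q\|_AP\xrightarrow{\alpha}Q\|_AP'$, $P\setminus A\xrightarrow{\alpha}P'\setminus A$, $P\Theta_AQ\xrightarrow{\alpha}P'\Theta_AQ$; if $P\xrightarrow{a}P'$, $Q\xrightarrow{a}Q'$, $a\in A$, then $P\|_AQ\xrightarrow{a}P'\|_AQ'$; if $P\xrightarrow{a}P'$, $a\in A$, then $P\setminus A\xrightarrow{\tau}P'\setminus A$ and $P\Theta_AQ\xrightarrow{a}Q$; if $P\xrightarrow{\alpha}P'$ then $P\triangle Q\xrightarrow{\alpha}P'\triangle Q$; if $Q\xrightarrow{\tau}Q'$ then $P\triangle Q\xrightarrow{\tau}P\triangle Q'$; if $Q\xrightarrow{a}Q'$ then $P\triangle Q\xrightarrow{a}Q'$; $\mu X.P\xrightarrow{\tau}P[\mu X.P/X]$. Write $P\Rightarrow Q$ if $P=P_0\xrightarrow{\tau}\cdots\xrightarrow{\tau}P_n=Q$ ($n\ge 0$); $P\overset{\alpha}{\Rightarrow}Q$ if $P\Rightarrow P'\xrightarrow{\alpha}Q'\Rightarrow Q$; $P\overset{\hat\alpha}{\Rightarrow}Q$ means $P\overset{\alpha}{\Rightarrow}Q$ if $\alpha\in\Sigma$ and $P\Rightarrow Q$ if $\alpha=\tau$. $P{\Uparrow}$ ($P$ diverges) if there are $P_0,P_1,\dots$ with $P\Rightarrow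 P_0\xrightarrow{\tau}P_1\xrightarrow{\tau}\cdots$. A coupled simulation is a relation $\mathcal R$ on CSP processes such that (i) if $P\mathcal RQ$ and $P\xrightarrow{\alpha}P'$ then $Q\overset{\hat\alpha}{\Rightarrow}Q'$ with $P'\mathcal RQ'$ for some $Q'$, and (ii) if $P\mathcal RQ$ then $Q\Rightarrow Q'$ with $Q'\mathcal RP$ for some $Q'$; it is divergence-preserving if $P\mathcal RQ$ and $P{\Uparrow}$ imply $Q{\Uparrow}$. $P\sqsupseteq_{CS}^\Delta Q$ (also written $Q\sqsubseteq_{CS}^\Delta P$) iff $P\mathcal RQ$ for some divergence-preserving coupled simulation $\mathcal R$; $P\equiv_{CS}^\Delta Q$ iff $P\sqsupseteq_{CS}^\Delta Q$ and $Q\sqsupseteq_{CS}^\Delta P$. -}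

module Defs where

open import Level using (0ℓ)
open import Data.Nat using (ℕ; suc; _≟_)
open import Data.List using (List; []; _∷_)
open import Data.List.Membership.Propositional using (_∈_)
open import Data.Product using (Σ; ∃; _×_; _,_; proj₁)
open import Data.Unit using (⊤)
open import Relation.Nullary using (¬_; yes; no)
open import Relation.Unary using (Pred)
open import Relation.Binary.Construct.Closure.ReflexiveTransitive using (Star)

Ident : Set
Ident = ℕ

module CSP (Sig : Set) where

  EvSet : Set₁
  EvSet = Pred Sig 0ℓ

  data Act : Set where
    τ  : Act
    ev : Sig → Act

  renAct : (Sig → Sig) → Act → Act
  renAct f τ      = τ
  renAct f (ev a) = ev (f a)

  _∉ᴬ_ : Act → EvSet → Set
  τ    ∉ᴬ A = ⊤
  ev a ∉ᴬ A = ¬ A a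

  infixr 6 _⟶_
  data Proc : Set₁ where
    STOP  : Proc
    div   : Proc
    _⟶_   : Sig → Proc → Proc
    _⊓_   : Proc → Proc → Proc
    _□_   : Proc → Proc → Proc
    _▷_   : Proc → Proc → Proc
    par   : Proc → EvSet → Proc → Proc
    hide  : Proc → EvSet → Proc
    ren   : (Sig → Sig) → Proc → Proc
    _△_   : Proc → Proc → Proc
    throw : Proc → EvSet → Proc → Proc
    var   : Ident → Proc
    μ     : Ident → Proc → Proc

  data WS (Γ : List Ident) : Proc → Set₁ where
    ws-STOP  : WS Γ STOP
    ws-div   : WS Γ div
    ws-pre   : ∀ {a P} → WS Γ P → WS Γ (a ⟶ P)
    ws-⊓     : ∀ {P Q} → WS Γ P → WS Γ Q → WS Γ (P ⊓ Q)
    ws-□     : ∀ {P Q} → WS Γ P → WS Γ Q → WS Γ (P □ Q)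
    ws-▷     : ∀ {P Q} → WS Γ P → WS Γ Q → WS Γ (P ▷ Q)
    ws-par   : ∀ {P A Q} → WS Γ P → WS Γ Q → WS Γ (par P A Q)
    ws-hide  : ∀ {P A} → WS Γ P → WS Γ (hide P A)
    ws-ren   : ∀ {f P} → WS Γ P → WS Γ (ren f P)
    ws-△     : ∀ {P Q} → WS Γ P → WS Γ Q → WS Γ (P △ Q)
    ws-throw : ∀ {P A Q} → WS Γ P → WS Γ Q → WS Γ (throw P A Q)
    ws-var   : ∀ {X} → X ∈ Γ → WS Γ (var X)
    ws-μ     : ∀ {X P} → WS (X ∷ Γ) P → WS Γ (μ X P)

  Closed : Proc → Set₁
  Closed = WS []

  CSPProc : Set₁
  CSPProc = Σ Proc Closed

  -- P[R/X]: substitute R for free occurrences of X (R is closed in use)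
  _[_/_] : Proc → Proc → Ident → Proc
  STOP [ R / X ] = STOP
  div [ R / X ] = div
  (a ⟶ P) [ R / X ] = a ⟶ (P [ R / X ])
  (P ⊓ Q) [ R / X ] = (P [ R / X ]) ⊓ (Q [ R / X ])
  (P □ Q) [ R / X ] = (P [ R / X ]) □ (Q [ R / X ])
  (P ▷ Q) [ R / X ] = (P [ R / X ]) ▷ (Q [ R / X ])
  par P A Q [ R / X ] = par (P [ R / X ]) A (Q [ R / X ])
  hide P A [ R / X ] = hide (P [ R / X ]) A
  ren f P [ R / X ] = ren f (P [ R / X ])
  (P △ Q) [ R / X ] = (P [ R / X ]) △ (Q [ R / X ])
  throw P A Q [ R / X ] = throw (P [ R / X ]) A (Q [ R / X ])
  var Y [ R / X ] with X ≟ Y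
  ... | yes _ = R
  ... | no  _ = var Y
  μ Y P [ R / X ] with X ≟ Y
  ... | yes _ = μ Y P
  ... | no  _ = μ Y (P [ R / X ])

  data _─_⟶_ : Proc → Act → Proc → Set₁ where
    div-τ    : div ─ τ ⟶ div
    pre      : ∀ {a P} → (a ⟶ P) ─ ev a ⟶ P
    ⊓-l      : ∀ {P Q} → (P ⊓ Q) ─ τ ⟶ P
    ⊓-r      : ∀ {P Q} → (P ⊓ Q) ─ τ ⟶ Q
    □-l      : ∀ {P Q P' a} → P ─ ev a ⟶ P' → (P □ Q) ─ ev a ⟶ P'
    □-r      : ∀ {P Q P' a} → P ─ ev a ⟶ P' → (Q □ P) ─ ev a ⟶ P'
    ▷-a      : ∀ {P Q P' a} → P ─ ev a ⟶ P' → (P ▷ Q) ─ ev a ⟶ P'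
    □-τl     : ∀ {P Q P'} → P ─ τ ⟶ P' → (P □ Q) ─ τ ⟶ (P' □ Q)
    □-τr     : ∀ {P Q P'} → P ─ τ ⟶ P' → (Q □ P) ─ τ ⟶ (Q □ P')
    ▷-τ      : ∀ {P Q P'} → P ─ τ ⟶ P' → (P ▷ Q) ─ τ ⟶ (P' ▷ Q)
    ▷-timeout : ∀ {P Q} → (P ▷ Q) ─ τ ⟶ Q
    ren-s    : ∀ {f P α P'} → P ─ α ⟶ P' → ren f P ─ renAct f α ⟶ ren f P'
    par-l    : ∀ {P Q α P' A} → P ─ α ⟶ P' → α ∉ᴬ A → par P A Q ─ α ⟶ par P' A Q
    par-r    : ∀ {P Q α P' A} → P ─ α ⟶ P' → α ∉ᴬ A → par Q A P ─ α ⟶ par Q A P'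
    hide-v   : ∀ {P α P' A} → P ─ α ⟶ P' → α ∉ᴬ A → hide P A ─ α ⟶ hide P' A
    throw-v  : ∀ {P Q α P' A} → P ─ α ⟶ P' → α ∉ᴬ A → throw P A Q ─ α ⟶ throw P' A Q
    par-sync : ∀ {P Q P' Q' a A} → P ─ ev a ⟶ P' → Q ─ ev a ⟶ Q' → A a →
               par P A Q ─ ev a ⟶ par P' A Q'
    hide-h   : ∀ {P P' a A} → P ─ ev a ⟶ P' → A a → hide P A ─ τ ⟶ hide P' A
    throw-h  : ∀ {P Q P' a A} → P ─ ev a ⟶ P' → A a → throw P A Q ─ ev a ⟶ Q
    △-l      : ∀ {P Q α P'} → P ─ α ⟶ P' → (P △ Q) ─ α ⟶ (P' △ Q)
    △-τr     : ∀ {P Q Q'} → Q ─ τ ⟶ Q' → (P △ Q) ─ τ ⟶ (P △ Q')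
    △-ar     : ∀ {P Q Q' a} → Q ─ ev a ⟶ Q' → (P △ Q) ─ ev a ⟶ Q'
    unfold   : ∀ {X P} → μ X P ─ τ ⟶ (P [ μ X P / X ])

  _─τ⟶_ : Proc → Proc → Set₁
  P ─τ⟶ Q = P ─ τ ⟶ Q

  _⇒_ : Proc → Proc → Set₁
  _⇒_ = Star _─τ⟶_

  _⟹[_]_ : Proc → Act → Proc → Set₁
  P ⟹[ α ] Q = ∃ λ P' → ∃ λ Q' → P ⇒ P' × P' ─ α ⟶ Q' × Q' ⇒ Q

  _⟹^[_]_ : Proc → Act → Proc → Set₁
  P ⟹^[ τ ] Q    = P ⇒ Q
  P ⟹^[ ev a ] Q = P ⟹[ ev a ] Q

  _⇑ : Proc → Set₁
  P ⇑ = ∃ λ (s : ℕ → Proc) → P ⇒ s 0 × (∀ i → s i ─τ⟶ s (suc i))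

  Rel : Set₂
  Rel = CSPProc → CSPProc → Set₁

  record IsDPCoupledSim (R : Rel) : Set₂ where
    field
      sim : ∀ {P Q : CSPProc} → R P Q → ∀ {α} {P' : CSPProc} →
            proj₁ P ─ α ⟶ proj₁ P' →
            ∃ λ (Q' : CSPProc) → (proj₁ Q ⟹^[ α ] proj₁ Q') × R P' Q'
      coupled : ∀ {P Q : CSPProc} → R P Q →
                ∃ λ (Q' : CSPProc) → (proj₁ Q ⇒ proj₁ Q') × R Q' P
      div-pres : ∀ {P Q : CSPProc} → R P Q → proj₁ P ⇑ → proj₁ Q ⇑

  _⊒CSΔ_ : CSPProc → CSPProc → Set₂
  P ⊒CSΔ Q = ∃ λ (R : Rel) → IsDPCoupledSim R × R P Q

  closed-ren : (f : Sig → Sig) → CSPProc → CSPProc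
  closed-ren f (P , c) = ren f P , ws-ren c

-- The renamed relation {(f(P), f(Q)) | P R Q} is again a divergence-preserving
-- coupled simulation: every move of f(P) is the f-image of a move of P, and weak
-- moves and divergences of Q lift along f. For divergence preservation one also
-- needs the converse, that a divergence of f(P) is the image of one of P, which
-- holds because every τ-step of f(P) comes from a τ-step of P.
module Submission where

open import Defs
open import Data.Nat using (zero; suc)
open import Data.Product using (∃; _×_; _,_; proj₁; proj₂)
open import Relation.Binary.PropositionalEquality using (_≡_; refl; subst)
open import Relation.Binary.Construct.Closure.ReflexiveTransitive using (ε; _◅_; gmap)
open import Function using (_∘_)

module Renaming (Sig : Set) where
  open CSP Sig

  ReflectsTau : (Proc → Proc) → Set₁
  ReflectsTau g = ∀ {x y} → g x ─τ⟶ y → ∃ λ x' → y ≡ g x' × x ─τ⟶ x'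

  module _ {g : Proc → Proc} (reflect : ReflectsTau g) where

    ⇒-reflect : ∀ {x y} → g x ⇒ y → ∃ λ x' → y ≡ g x' × x ⇒ x'
    ⇒-reflect ε = _ , refl , ε
    ⇒-reflect (step ◅ steps) with reflect step
    ... | x₁ , refl , step' with ⇒-reflect steps
    ...   | x' , eq , steps' = x' , eq , step' ◅ steps'

    ⇑-reflect : ∀ {x} → g x ⇑ → x ⇑
    ⇑-reflect (s , path , steps) =
      (λ i → proj₁ (origin i)) , proj₂ (proj₂ (⇒-reflect path)) , λ i → proj₂ (proj₂ (next i))
      where
        origin : ∀ i → ∃ λ x' → s i ≡ g x'
        next : ∀ i → ∃ λ x' → s (suc i) ≡ g x' × proj₁ (origin i) ─τ⟶ x'

        origin zero = proj₁ (⇒-reflect path) , proj₁ (proj₂ (⇒-reflect path))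
        origin (suc i) = proj₁ (next i) , proj₁ (proj₂ (next i))

        next i = reflect (subst (_─τ⟶ s (suc i)) (proj₂ (origin i)) (steps i))

  module _ (f : Sig → Sig) where

    ren-reflectsTau : ReflectsTau (ren f)
    ren-reflectsTau step = invert step refl
      where
        -- the action must be generalised: the index renAct f α does not unify with τ
        invert : ∀ {x y α} → ren f x ─ α ⟶ y → α ≡ τ → ∃ λ x' → y ≡ ren f x' × x ─τ⟶ x'
        invert (ren-s {α = τ} step) refl = _ , refl , step

    ren-⇒ : ∀ {x y} → x ⇒ y → ren f x ⇒ ren f y
    ren-⇒ = gmap (ren f) ren-s

    ren-⟹^ : ∀ {x y} α → x ⟹^[ α ] y → ren f x ⟹^[ renAct f α ] ren f y
    ren-⟹^ τ      path = ren-⇒ path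
    ren-⟹^ (ev a) (x' , y' , before , step , after) =
      ren f x' , ren f y' , ren-⇒ before , ren-s step , ren-⇒ after

    ren-⇑ : ∀ {x} → x ⇑ → ren f x ⇑
    ren-⇑ (s , path , steps) = (λ i → ren f (s i)) , ren-⇒ path , λ i → ren-s (steps i)

    data Renamed (R : Rel) : Rel where
      renamed : ∀ {p c q d} → R (p , c) (q , d) → Renamed R (closed-ren f (p , c)) (closed-ren f (q , d))

    Renamed-isDPCoupledSim : ∀ {R} → IsDPCoupledSim R → IsDPCoupledSim (Renamed R)
    Renamed-isDPCoupledSim {R} isR = record { sim = sim′ ; coupled = coupled′ ; div-pres = div-pres′ }
      where
        open IsDPCoupledSim isR

        sim′ : ∀ {P Q} → Renamed R P Q → ∀ {α} {P' : CSPProc} → proj₁ P ─ α ⟶ proj₁ P' →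
               ∃ λ (Q' : CSPProc) → (proj₁ Q ⟹^[ α ] proj₁ Q') × Renamed R P' Q'
        sim′ (renamed r) {P' = _ , ws-ren c'} (ren-s {α = α} step) with sim r {P' = _ , c'} step
        ... | Q' , weak , r' = closed-ren f Q' , ren-⟹^ α weak , renamed r'

        coupled′ : ∀ {P Q} → Renamed R P Q → ∃ λ (Q' : CSPProc) → (proj₁ Q ⇒ proj₁ Q') × Renamed R Q' P
        coupled′ (renamed r) with coupled r
        ... | Q' , path , r' = closed-ren f Q' , ren-⇒ path , renamed r'

        div-pres′ : ∀ {P Q} → Renamed R P Q → proj₁ P ⇑ → proj₁ Q ⇑
        div-pres′ (renamed r) = ren-⇑ ∘ div-pres r ∘ ⇑-reflect ren-reflectsTau

open Renaming

proposition11 : (Sig : Set) → let open CSP Sig in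
    (f : Sig → Sig) (P Q : CSPProc) →
    P ⊒CSΔ Q → closed-ren f P ⊒CSΔ closed-ren f Q
proposition11 Sig f P Q (R , isR , r) = Renamed Sig f R , Renamed-isDPCoupledSim Sig f isR , renamed r
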